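{- For every positive integer $n$, $$\mathrm{capt}(Q_n) \le n \lceil \log_2 n\rceil - \left\lfloor \frac{n-1}{2} \right\rfloor + 1 = (1+o(1))\, n \log_2 n.$$
   Context: Cops and Robbers is played on a finite reflexive graph (every vertex carries a loop, so a player may pass). The cops first choose starting vertices (turn 0), then the robber chooses a starting vertex; afterwards players alternate, the cops moving first: each cop moves to a neighbouring vertex or stays, then the robber moves to a neighbouring vertex or stays. A round is a cop move together with the subsequent robber move. The cops win when some cop occupies the same vertex as the robber. The cop number $c(G)$ is the minimum number of cops having a winning strategy; $\mathrm{capt}(G)$ is the minimum, over strategies of $c(G)$ cops, of the number of rounds (not counting round 0) needed to capture the robber, assuming the robber plays to delay capture as long as possible. $Q_n$ is the $n$-dimensional hypercube (the $n$-fold Cartesian product of $K_2$), with $c(Q_n)=\lceil (n+1)/2\rceil$. -}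

module Defs where

open import Data.Nat using (ℕ; zero; suc)
open import Data.Bool using (Bool)
open import Data.Fin using (Fin)
open import Data.Vec using (Vec; lookup)
open import Data.Vec.Relation.Unary.Any using (Any)
open import Data.Vec.Relation.Binary.Pointwise.Inductive using (Pointwise)
open import Data.Product using (Σ; _×_)
open import Data.Sum using (_⊎_)
open import Relation.Binary.PropositionalEquality using (_≡_; _≢_)

Cube : ℕ → Set
Cube n = Vec Bool n

AdjQ : ∀ {n} → Cube n → Cube n → Set
AdjQ {n} x y = x ≡ y ⊎ Σ (Fin n) λ i →
  (lookup x i ≢ lookup y i) × (∀ j → j ≢ i → lookup x j ≡ lookup y j)

module Game (V : Set) (Adj : V → V → Set) where

  Caught : ∀ {k} → Vec V k → V → Set
  Caught C r = Any (λ c → c ≡ r) C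

  -- every cop moves to a neighbouring vertex (or stays, via reflexivity of Adj)
  CopMove : ∀ {k} → Vec V k → Vec V k → Set
  CopMove C C' = Pointwise Adj C C'

  -- WinWithin t C r : cops at C, robber at r, cops to move; the cops can
  -- force capture within at most t further rounds, whatever the robber does.
  data WinWithin {k : ℕ} : ℕ → Vec V k → V → Set where
    caught : ∀ {t C r} → Caught C r → WinWithin t C r
    step   : ∀ {t C r} (C' : Vec V k) → CopMove C C' →
             (Caught C' r ⊎ (∀ r' → Adj r r' → WinWithin t C' r')) →
             WinWithin (suc t) C r

  -- k cops have a strategy capturing the robber within T rounds
  -- (round 0 = choice of starting positions, not counted).
  CaptureWithin : ℕ → ℕ → Set
  CaptureWithin k T = Σ (Vec V k) λ C₀ → ∀ r₀ → WinWithin T C₀ r₀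

module QGame (n : ℕ) = Game (Cube n) (AdjQ {n})

module Submission where

-- The cops form a binary team tree.  A leaf is a single cop guarding Q_1 (an edge cop,
-- which always catches) or Q_2 (a square cop, which can only pin the robber to its
-- antipode).  An inner node splits the coordinates into two blocks; each subteam first
-- walks its offset in the other block onto the robber's coordinates there and then plays
-- its own game inside its block.  A potential (distance to alignment plus the inner bound
-- for a misaligned subteam, the inner potential for an aligned one) drops in every round
-- unless a cop is next to the robber, so a general potential argument for the game yields
-- capture within bound + 1 rounds.  Finally `attach` arranges a seed of one or two edge
-- cops and ⌊(n−1)/2⌋ square cops in a tree of depth ⌈log₂ n⌉ − 1; its bound is computed
-- by induction, and a little arithmetic gives the stated capture time.

open import Defs
open import Data.Nat using (ℕ; _+_; _*_; _∸_; NonZero; ⌈_/2⌉; ⌊_/2⌋)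
open import Data.Nat.Logarithm using (⌈log₂_⌉)

open import Data.Nat using (zero; suc; _^_; _≤_; _<_; z≤n; s≤s)
open import Data.Nat.Properties
open import Data.Nat.Logarithm using (⌈log₂⌈n/2⌉⌉≡⌈log₂n⌉∸1; ⌈log₂⌉-mono-≤)
open import Data.Nat.Logarithm.Core using (⌈log2⌉)
open import Induction.WellFounded using (Acc; acc)
open import Data.Bool using (false; not)
open import Data.Bool.Properties using (¬-not; not-injective) renaming (_≟_ to _≟ᵇ_)
open import Data.Fin using (Fin) renaming (zero to fzero; suc to fsuc)
import Data.Fin.Properties as Fin
open import Data.Vec using (Vec; []; _∷_; _++_; lookup; map; replicate; take; drop)
open import Data.Vec.Properties using (≡-dec; ∷-injective; ++-injectiveˡ; ++-injectiveʳ; take++drop≡id)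
open import Data.Vec.Relation.Unary.Any using (Any; here; there)
import Data.Vec.Relation.Unary.Any as Any
import Data.Vec.Relation.Unary.Any.Properties as Any
open import Data.Vec.Relation.Binary.Pointwise.Inductive using (Pointwise; []; _∷_)
import Data.Vec.Relation.Binary.Pointwise.Inductive as Pointwise
import Data.Vec.Relation.Binary.Pointwise.Extensional as Extensional
open import Data.Product using (Σ; _×_; _,_; proj₁; proj₂)
open import Data.Sum using (_⊎_; inj₁; inj₂)
open import Data.Empty using (⊥; ⊥-elim)
open import Data.Unit using (⊤; tt)
open import Relation.Nullary using (¬_; Dec; yes; no)
open import Relation.Binary.PropositionalEquality
open import Data.Nat.Tactic.RingSolver using (solve-∀)

data Flip : ∀ {n} → Cube n → Cube n → Set where
  flipHead : ∀ {n a b} {xs : Cube n} → a ≢ b → Flip (a ∷ xs) (b ∷ xs)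
  flipTail : ∀ {n a} {xs ys : Cube n} → Flip xs ys → Flip (a ∷ xs) (a ∷ ys)

Adjacent : ∀ {n} → Cube n → Cube n → Set
Adjacent x y = x ≡ y ⊎ Flip x y

Flip-irreflexive : ∀ {n} {x : Cube n} → ¬ Flip x x
Flip-irreflexive (flipHead a≢a) = a≢a refl
Flip-irreflexive (flipTail f)   = Flip-irreflexive f

DiffersOnlyAt : ∀ {n} → Cube n → Cube n → Fin n → Set
DiffersOnlyAt x y i = (lookup x i ≢ lookup y i) × (∀ j → j ≢ i → lookup x j ≡ lookup y j)

Flip⇒DiffersOnlyAt : ∀ {n} {x y : Cube n} → Flip x y → Σ (Fin n) (DiffersOnlyAt x y)
Flip⇒DiffersOnlyAt (flipHead a≢b) = fzero , a≢b , λ { fzero 0≢0 → ⊥-elim (0≢0 refl) ; (fsuc j) _ → refl }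
Flip⇒DiffersOnlyAt (flipTail f) with Flip⇒DiffersOnlyAt f
... | i , differs , same = fsuc i , differs , λ { fzero _ → refl ; (fsuc j) j≢i → same j (λ j≡i → j≢i (cong fsuc j≡i)) }

DiffersOnlyAt⇒Flip : ∀ {n} (x y : Cube n) i → DiffersOnlyAt x y i → Flip x y
DiffersOnlyAt⇒Flip (a ∷ xs) (b ∷ ys) fzero (a≢b , same) with tails-equal
  where
  tails-equal : xs ≡ ys
  tails-equal = Extensional.Pointwise-≡⇒≡ (Extensional.ext (λ j → same (fsuc j) (λ ())))
... | refl = flipHead a≢b
DiffersOnlyAt⇒Flip (a ∷ xs) (b ∷ ys) (fsuc i) (differs , same) with same fzero (λ ())
... | refl = flipTail (DiffersOnlyAt⇒Flip xs ys i (differs , λ j j≢i → same (fsuc j) (λ e → j≢i (Fin.suc-injective e))))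

Adjacent⇒AdjQ : ∀ {n} {x y : Cube n} → Adjacent x y → AdjQ x y
Adjacent⇒AdjQ (inj₁ x≡y) = inj₁ x≡y
Adjacent⇒AdjQ (inj₂ f)   = inj₂ (Flip⇒DiffersOnlyAt f)

AdjQ⇒Adjacent : ∀ {n} {x y : Cube n} → AdjQ x y → Adjacent x y
AdjQ⇒Adjacent (inj₁ x≡y)     = inj₁ x≡y
AdjQ⇒Adjacent (inj₂ (i , d)) = inj₂ (DiffersOnlyAt⇒Flip _ _ i d)

Flip-++ˡ : ∀ {m n} {x x' : Cube m} (v : Cube n) → Flip x x' → Flip (x ++ v) (x' ++ v)
Flip-++ˡ v (flipHead a≢b) = flipHead a≢b
Flip-++ˡ v (flipTail f)   = flipTail (Flip-++ˡ v f)

Flip-++ʳ : ∀ {m n} (v : Cube m) {y y' : Cube n} → Flip y y' → Flip (v ++ y) (v ++ y')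
Flip-++ʳ []      f = f
Flip-++ʳ (a ∷ v) f = flipTail (Flip-++ʳ v f)

Adjacent-++ˡ : ∀ {m n} {x x' : Cube m} (v : Cube n) → Adjacent x x' → Adjacent (x ++ v) (x' ++ v)
Adjacent-++ˡ v (inj₁ refl) = inj₁ refl
Adjacent-++ˡ v (inj₂ f)    = inj₂ (Flip-++ˡ v f)

Adjacent-++ʳ : ∀ {m n} (v : Cube m) {y y' : Cube n} → Adjacent y y' → Adjacent (v ++ y) (v ++ y')
Adjacent-++ʳ v (inj₁ refl) = inj₁ refl
Adjacent-++ʳ v (inj₂ f)    = inj₂ (Flip-++ʳ v f)

Flip-++⁻ : ∀ {m n} (x x' : Cube m) {y y' : Cube n} → Flip (x ++ y) (x' ++ y') →
           (Flip x x' × y ≡ y') ⊎ (x ≡ x' × Flip y y')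
Flip-++⁻ x x' f = split x x' f refl refl
  where
  split : ∀ {m n} (x x' : Cube m) {y y' : Cube n} {u w : Cube (m + n)} → Flip u w →
          u ≡ x ++ y → w ≡ x' ++ y' → (Flip x x' × y ≡ y') ⊎ (x ≡ x' × Flip y y')
  split [] [] f refl refl = inj₂ (refl , f)
  split (a ∷ x) (b ∷ x') (flipHead a≢b) u≡ w≡
    with ∷-injective u≡ | ∷-injective w≡
  ... | refl , xy≡ | refl , x'y'≡ with trans (sym xy≡) x'y'≡
  ... | xy≡x'y' with ++-injectiveˡ x x' xy≡x'y' | ++-injectiveʳ x x' xy≡x'y'
  ... | refl | refl = inj₁ (flipHead a≢b , refl)
  split (a ∷ x) (b ∷ x') (flipTail f) u≡ w≡
    with ∷-injective u≡ | ∷-injective w≡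
  ... | refl , xy≡ | refl , x'y'≡ with split x x' f xy≡ x'y'≡
  ... | inj₁ (fx , y≡y')   = inj₁ (flipTail fx , y≡y')
  ... | inj₂ (refl , fy)  = inj₂ (refl , fy)

dist : ∀ {n} → Cube n → Cube n → ℕ
dist []       []       = 0
dist (a ∷ xs) (b ∷ ys) with a ≟ᵇ b
... | yes _ = dist xs ys
... | no  _ = suc (dist xs ys)

dist-refl : ∀ {n} (x : Cube n) → dist x x ≡ 0
dist-refl []       = refl
dist-refl (a ∷ xs) with a ≟ᵇ a
... | yes _   = dist-refl xs
... | no a≢a  = ⊥-elim (a≢a refl)

dist≤dim : ∀ {n} (x y : Cube n) → dist x y ≤ n
dist≤dim []       []       = z≤n
dist≤dim (a ∷ xs) (b ∷ ys) with a ≟ᵇ b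
... | yes _ = m≤n⇒m≤1+n (dist≤dim xs ys)
... | no  _ = s≤s (dist≤dim xs ys)

dist-Adjacent : ∀ {n} (x : Cube n) {y y' : Cube n} → Adjacent y y' → dist x y' ≤ suc (dist x y)
dist-Adjacent x (inj₁ refl) = n≤1+n _
dist-Adjacent x (inj₂ f)    = dist-Flip x f
  where
  dist-Flip : ∀ {n} (x : Cube n) {y y' : Cube n} → Flip y y' → dist x y' ≤ suc (dist x y)
  dist-Flip (a ∷ xs) {b ∷ ys} (flipHead {b = b'} _) with a ≟ᵇ b | a ≟ᵇ b'
  ... | yes _ | yes _ = n≤1+n _
  ... | yes _ | no  _ = ≤-refl
  ... | no  _ | yes _ = m≤n⇒m≤1+n (n≤1+n _)
  ... | no  _ | no  _ = n≤1+n _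
  dist-Flip (a ∷ xs) {b ∷ ys} (flipTail f) with a ≟ᵇ b
  ... | yes _ = dist-Flip xs f
  ... | no  _ = s≤s (dist-Flip xs f)

towards : ∀ {n} → Cube n → Cube n → Cube n
towards []       []       = []
towards (a ∷ xs) (b ∷ ys) with a ≟ᵇ b
... | yes _ = a ∷ towards xs ys
... | no  _ = b ∷ xs

towards-Flip : ∀ {n} (v y : Cube n) → v ≢ y → Flip v (towards v y)
towards-Flip []       []       v≢y = ⊥-elim (v≢y refl)
towards-Flip (a ∷ xs) (b ∷ ys) v≢y with a ≟ᵇ b
... | yes refl = flipTail (towards-Flip xs ys (λ xs≡ys → v≢y (cong (a ∷_) xs≡ys)))
... | no  a≢b  = flipHead a≢b

towards-dist : ∀ {n} (v y : Cube n) → v ≢ y → suc (dist (towards v y) y) ≡ dist v y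
towards-dist []       []       v≢y = ⊥-elim (v≢y refl)
towards-dist (a ∷ xs) (b ∷ ys) v≢y with a ≟ᵇ b
... | yes refl with a ≟ᵇ a
...   | yes _   = towards-dist xs ys (λ xs≡ys → v≢y (cong (a ∷_) xs≡ys))
...   | no a≢a  = ⊥-elim (a≢a refl)
towards-dist (a ∷ xs) (b ∷ ys) v≢y | no _ with b ≟ᵇ b
...   | yes _   = refl
...   | no b≢b  = ⊥-elim (b≢b refl)

towards-neighbour : ∀ {n} {v y : Cube n} → Flip v y → towards v y ≡ y
towards-neighbour {v = a ∷ xs} {b ∷ _} (flipHead a≢b) with a ≟ᵇ b
... | yes a≡b = ⊥-elim (a≢b a≡b)
... | no  _   = refl
towards-neighbour {v = a ∷ xs} (flipTail f) with a ≟ᵇ a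
... | yes _   = cong (a ∷_) (towards-neighbour f)
... | no a≢a  = ⊥-elim (a≢a refl)

module GameFacts (V : Set) (Adj : V → V → Set) (Adj-refl : ∀ {x} → Adj x x) where
  open Game V Adj

  WinWithin-mono : ∀ {k t t'} {C : Vec V k} {r} → t ≤ t' → WinWithin t C r → WinWithin t' C r
  WinWithin-mono _         (caught c)            = caught c
  WinWithin-mono (s≤s t≤t') (step C' m (inj₁ c)) = step C' m (inj₁ c)
  WinWithin-mono (s≤s t≤t') (step C' m (inj₂ w)) = step C' m (inj₂ λ r' a → WinWithin-mono t≤t' (w r' a))

  CaptureWithin-mono : ∀ {k t t'} → t ≤ t' → CaptureWithin k t → CaptureWithin k t'
  CaptureWithin-mono t≤t' (C₀ , win) = C₀ , λ r₀ → WinWithin-mono t≤t' (win r₀)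

  catch : ∀ {k} {C : Vec V k} {r} → Any (λ c → Adj c r) C → Σ (Vec V k) λ C' → CopMove C C' × Caught C' r
  catch {C = c ∷ C} {r} (here a) = r ∷ C , a ∷ Pointwise.refl Adj-refl , here refl
  catch {C = c ∷ C} (there as) with catch as
  ... | C' , m , hit = c ∷ C' , Adj-refl ∷ m , there hit

  record PotentialStrategy (k : ℕ) : Set₁ where
    field
      Config   : Set
      cops     : Config → Vec V k
      respond  : Config → V → Config
      Φ        : Config → V → ℕ
      legal    : ∀ s r → CopMove (cops s) (cops (respond s r))
      progress : ∀ s r r' → Adj r r' →
                 suc (Φ (respond s r') r') ≤ Φ s r ⊎ Any (λ c → Adj c r') (cops s)

  potentialCapture : ∀ {k} (P : PotentialStrategy k) (s₀ : PotentialStrategy.Config P) (B : ℕ) →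
                     (∀ r → PotentialStrategy.Φ P s₀ r ≤ B) → CaptureWithin k (suc B)
  potentialCapture P s₀ B Φ₀≤B = cops s₀ , λ r₀ → win B s₀ r₀ (Φ₀≤B r₀) r₀ Adj-refl
    where
    open PotentialStrategy P
    win : ∀ t s r → Φ s r ≤ t → ∀ r' → Adj r r' → WinWithin (suc t) (cops s) r'
    win t s r Φ≤t r' a with progress s r r' a
    ... | inj₂ near with catch near
    ...   | C' , m , hit = step C' m (inj₁ hit)
    win zero    s r Φ≤t r' a | inj₁ lower with ≤-trans lower Φ≤t
    ... | ()
    win (suc t) s r Φ≤t r' a | inj₁ lower =
      step (cops (respond s r')) (legal s r')
           (inj₂ (win t (respond s r') r' (≤-pred (≤-trans lower Φ≤t))))

-- A leaf is a single cop: an "edge" cop guarding Q_1, or a "square" cop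
-- guarding Q_2 (one cop cannot catch on Q_2, but can confine the robber to its antipode).
-- join a b splits the coordinates into a block for a followed by a block for b; each
-- subteam plays inside its own block, holding the other block at an offset that it
-- first steers onto the robber's coordinates there.
data Tree : Set where
  edge square : Tree
  join : Tree → Tree → Tree

dim : Tree → ℕ
dim edge       = 1
dim square     = 2
dim (join a b) = dim a + dim b

copCount : Tree → ℕ
copCount edge       = 1
copCount square     = 1
copCount (join a b) = copCount a + copCount b

-- Bound on the potential, hence on the capture time minus one.
bound : Tree → ℕ
bound edge       = 0
bound square     = 1
bound (join a b) = (dim b + bound a) + (dim a + bound b)

-- The leftmost leaf is an edge cop: this team makes progress even when the robber passes.
EdgeFirst : Tree → Set
EdgeFirst edge       = ⊤
EdgeFirst square     = ⊥
EdgeFirst (join a _) = EdgeFirst a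

mutual
  State : Tree → Set
  State edge       = Cube 1
  State square     = Cube 2
  State (join a b) = Team a (dim b) × Team b (dim a)

  -- A subteam inside a product with m further coordinates: its state and its offset.
  Team : Tree → ℕ → Set
  Team t m = State t × Cube m

Split : Tree → Set
Split edge       = Cube 1
Split square     = Cube 2
Split (join a b) = Split a × Split b

flatten : ∀ t → Split t → Cube (dim t)
flatten edge       r          = r
flatten square     r          = r
flatten (join a b) (ra , rb)  = flatten a ra ++ flatten b rb

split : ∀ t → Cube (dim t) → Split t
split edge       x = x
split square     x = x
split (join a b) x = split a (take (dim a) x) , split b (drop (dim a) x)

flatten-split : ∀ t x → flatten t (split t x) ≡ x
flatten-split edge       x = refl
flatten-split square     x = refl
flatten-split (join a b) x =
  trans (cong₂ _++_ (flatten-split a (take (dim a) x)) (flatten-split b (drop (dim a) x)))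
        (take++drop≡id (dim a) x)

flatten-injective : ∀ t {r r' : Split t} → flatten t r ≡ flatten t r' → r ≡ r'
flatten-injective edge       e = e
flatten-injective square     e = e
flatten-injective (join a b) {ra , rb} {ra' , rb'} e =
  cong₂ _,_ (flatten-injective a (++-injectiveˡ (flatten a ra) (flatten a ra') e))
            (flatten-injective b (++-injectiveʳ (flatten a ra) (flatten a ra') e))

record Placement (p q N : ℕ) : Set where
  field
    place      : Cube p → Cube q → Cube N
    place-adjˡ : ∀ {x x'} v → Adjacent x x' → Adjacent (place x v) (place x' v)
    place-adjʳ : ∀ x {v v'} → Adjacent v v' → Adjacent (place x v) (place x v')
open Placement

leftBlock : ∀ {p q} → Placement p q (p + q)
leftBlock = record { place = _++_ ; place-adjˡ = Adjacent-++ˡ ; place-adjʳ = Adjacent-++ʳ }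

rightBlock : ∀ {p q} → Placement p q (q + p)
rightBlock = record { place = λ x v → v ++ x
                    ; place-adjˡ = λ v → Adjacent-++ʳ v ; place-adjʳ = λ x → Adjacent-++ˡ x }

mutual
  positions : ∀ t → State t → Vec (Cube (dim t)) (copCount t)
  positions edge       s       = s ∷ []
  positions square     s       = s ∷ []
  positions (join a b) (A , B) = teamPositions a leftBlock A ++ teamPositions b rightBlock B

  teamPositions : ∀ {m N} t → Placement (dim t) m N → Team t m → Vec (Cube N) (copCount t)
  teamPositions t P (s , v) = map (λ x → place P x v) (positions t s)

_≟ᶜ_ : ∀ {n} (x y : Cube n) → Dec (x ≡ y)
_≟ᶜ_ = ≡-dec _≟ᵇ_

mutual
  respond : ∀ t → State t → Split t → State t
  respond edge       s       r         = s
  respond square     s       r         = s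
  respond (join a b) (A , B) (ra , rb) = advance a A ra (flatten b rb) , advance b B rb (flatten a ra)

  advance : ∀ {m} t → Team t m → Split t → Cube m → Team t m
  advance t (s , v) r y with v ≟ᶜ y
  ... | yes _ = respond t s r , v
  ... | no  _ = s , towards v y

antipode : ∀ {n} → Cube n → Cube n
antipode = map not

-- The square cop has a spare move left unless it sits at the robber's antipode.
squarePotential : Cube 2 → Cube 2 → ℕ
squarePotential s r with s ≟ᶜ antipode r
... | yes _ = 0
... | no  _ = 1

mutual
  potential : ∀ t → State t → Split t → ℕ
  potential edge       s       r         = 0
  potential square     s       r         = squarePotential s r
  potential (join a b) (A , B) (ra , rb) =
    teamPotential a A ra (flatten b rb) + teamPotential b B rb (flatten a ra)

  teamPotential : ∀ {m} t → Team t m → Split t → Cube m → ℕ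
  teamPotential t (s , v) r y with v ≟ᶜ y
  ... | yes _ = potential t s r
  ... | no  _ = dist v y + bound t

teamPotential-aligned : ∀ {m} t s (v : Cube m) r y → v ≡ y → teamPotential t (s , v) r y ≡ potential t s r
teamPotential-aligned t s v r y v≡y with v ≟ᶜ y
... | yes _   = refl
... | no v≢y  = ⊥-elim (v≢y v≡y)

teamPotential-misaligned : ∀ {m} t s (v : Cube m) r y → v ≢ y → teamPotential t (s , v) r y ≡ dist v y + bound t
teamPotential-misaligned t s v r y v≢y with v ≟ᶜ y
... | yes v≡y = ⊥-elim (v≢y v≡y)
... | no  _   = refl

squarePotential≤1 : ∀ s r → squarePotential s r ≤ 1
squarePotential≤1 s r with s ≟ᶜ antipode r
... | yes _ = z≤n
... | no  _ = ≤-refl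

mutual
  potential≤bound : ∀ t s r → potential t s r ≤ bound t
  potential≤bound edge       s       r         = z≤n
  potential≤bound square     s       r         = squarePotential≤1 s r
  potential≤bound (join a b) (A , B) (ra , rb) =
    +-mono-≤ (teamPotential≤ a A ra (flatten b rb)) (teamPotential≤ b B rb (flatten a ra))

  teamPotential≤ : ∀ {m} t T r (y : Cube m) → teamPotential t T r y ≤ m + bound t
  teamPotential≤ {m} t (s , v) r y with v ≟ᶜ y
  ... | yes _ = ≤-trans (potential≤bound t s r) (m≤n+m (bound t) m)
  ... | no  _ = +-monoˡ-≤ (bound t) (dist≤dim v y)

teamPotential≤misaligned : ∀ {m} t T r (y : Cube m) → teamPotential t T r y ≤ dist (proj₂ T) y + bound t
teamPotential≤misaligned t (s , v) r y with v ≟ᶜ y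
... | yes refl = ≤-trans (potential≤bound t s r) (≤-reflexive (cong (_+ bound t) (sym (dist-refl v))))
... | no  _    = ≤-refl

towards-lowers : ∀ {m} t s (v : Cube m) r y → v ≢ y →
                 suc (teamPotential t (s , towards v y) r y) ≤ dist v y + bound t
towards-lowers t s v r y v≢y = begin
  suc (teamPotential t (s , towards v y) r y) ≤⟨ s≤s (teamPotential≤misaligned t (s , towards v y) r y) ⟩
  suc (dist (towards v y) y) + bound t        ≡⟨ cong (_+ bound t) (towards-dist v y v≢y) ⟩
  dist v y + bound t                          ∎
  where open ≤-Reasoning

map-pointwise : ∀ {A B : Set} {R : B → B → Set} {f g : A → B} →
                (∀ x → R (f x) (g x)) → ∀ {k} (xs : Vec A k) → Pointwise R (map f xs) (map g xs)
map-pointwise fRg []       = []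
map-pointwise fRg (x ∷ xs) = fRg x ∷ map-pointwise fRg xs

mutual
  respond-legal : ∀ t s r → Pointwise Adjacent (positions t s) (positions t (respond t s r))
  respond-legal edge       s       r         = inj₁ refl ∷ []
  respond-legal square     s       r         = inj₁ refl ∷ []
  respond-legal (join a b) (A , B) (ra , rb) =
    Pointwise.++⁺ (advance-legal a leftBlock A ra (flatten b rb)) (advance-legal b rightBlock B rb (flatten a ra))

  advance-legal : ∀ {m N} t (P : Placement (dim t) m N) T r y →
                  Pointwise Adjacent (teamPositions t P T) (teamPositions t P (advance t T r y))
  advance-legal t P (s , v) r y with v ≟ᶜ y
  ... | yes _   = Pointwise.map⁺ (place-adjˡ P v) (respond-legal t s r)
  ... | no v≢y  = map-pointwise (λ x → place-adjʳ P x (inj₂ (towards-Flip v y v≢y))) (positions t s)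

Threat : ∀ t → State t → Split t → Set
Threat t s r = Any (λ c → Adjacent c (flatten t r)) (positions t s)

Progress : ∀ t → State t → Split t → Split t → Set
Progress t s r r' = suc (potential t (respond t s r') r') ≤ potential t s r ⊎ Threat t s r'

TeamProgress : ∀ {m} t → Team t m → Split t → Split t → Cube m → Set
TeamProgress t T r r' y =
  suc (teamPotential t (advance t T r' y) r' y) ≤ teamPotential t T r y ⊎ (proj₂ T ≡ y × Threat t (proj₁ T) r')

teamThreat : ∀ {m N} t (P : Placement (dim t) m N) s v r → Threat t s r →
             Any (λ c → Adjacent c (place P (flatten t r) v)) (teamPositions t P (s , v))
teamThreat t P s v r threat = Any.map⁺ (Any.map (place-adjˡ P v) threat)

liftProgress : ∀ {m} t (T : Team t m) r r' y → Progress t (proj₁ T) r r' → TeamProgress t T r r' y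
liftProgress t (s , v) r r' y p with v ≟ᶜ y | p
... | no v≢y  | _            = inj₁ (towards-lowers t s v r' y v≢y)
... | yes v≡y | inj₂ threat  = inj₂ (v≡y , threat)
... | yes v≡y | inj₁ lower   =
  inj₁ (subst (λ q → suc q ≤ potential t s r) (sym (teamPotential-aligned t (respond t s r') v r' y v≡y)) lower)

mutual
  respond-steady : ∀ t s r → potential t (respond t s r) r ≤ potential t s r
  respond-steady edge       s       r         = ≤-refl
  respond-steady square     s       r         = ≤-refl
  respond-steady (join a b) (A , B) (ra , rb) =
    +-mono-≤ (advance-steady a A ra (inj₁ refl)) (advance-steady b B rb (inj₁ refl))

  advance-steady : ∀ {m} t T r {y y' : Cube m} → Adjacent y y' →
                   teamPotential t (advance t T r y') r y' ≤ teamPotential t T r y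
  advance-steady t (s , v) r {y} {y'} y~y' with v ≟ᶜ y'
  advance-steady t (s , v) r (inj₁ refl) | yes refl
    rewrite teamPotential-aligned t (respond t s r) v r v refl | teamPotential-aligned t s v r v refl =
    respond-steady t s r
  advance-steady t (s , v) r {y} (inj₂ y↔v) | yes refl
    rewrite teamPotential-aligned t (respond t s r) v r v refl
          | teamPotential-misaligned t s v r y (λ { refl → Flip-irreflexive y↔v }) =
    ≤-trans (potential≤bound t (respond t s r) r) (m≤n+m (bound t) (dist v y))
  advance-steady t (s , v) r {y} {y'} y~y' | no v≢y' with v ≟ᶜ y | y~y'
  ... | yes refl | inj₁ refl   = ⊥-elim (v≢y' refl)
  ... | yes refl | inj₂ v↔y'
    rewrite towards-neighbour v↔y' | teamPotential-aligned t s y' r y' refl = ≤-refl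
  ... | no  v≢y  | _           = begin
    teamPotential t (s , towards v y') r y' ≤⟨ teamPotential≤misaligned t (s , towards v y') r y' ⟩
    dist (towards v y') y' + bound t       ≤⟨ +-monoˡ-≤ (bound t) (≤-pred closer) ⟩
    dist v y + bound t                     ∎
    where
    open ≤-Reasoning
    closer : suc (dist (towards v y') y') ≤ suc (dist v y)
    closer = ≤-trans (≤-reflexive (towards-dist v y' v≢y')) (dist-Adjacent v y~y')

edge-adjacent : (x y : Cube 1) → Adjacent x y
edge-adjacent (a ∷ []) (b ∷ []) with a ≟ᵇ b
... | yes refl = inj₁ refl
... | no  a≢b  = inj₂ (flipHead a≢b)

square-adjacent-or-antipodal : (x y : Cube 2) → Adjacent x y ⊎ x ≡ antipode y
square-adjacent-or-antipodal (a ∷ b ∷ []) (c ∷ d ∷ []) with a ≟ᵇ c | b ≟ᵇ d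
... | yes refl | yes refl = inj₁ (inj₁ refl)
... | no  a≢c  | yes refl = inj₁ (inj₂ (flipHead a≢c))
... | yes refl | no  b≢d  = inj₁ (inj₂ (flipTail (flipHead b≢d)))
... | no  a≢c  | no  b≢d  = inj₂ (cong₂ (λ p q → p ∷ q ∷ []) (¬-not a≢c) (¬-not b≢d))

antipode-injective : ∀ {n} (x y : Cube n) → antipode x ≡ antipode y → x ≡ y
antipode-injective []       []       _ = refl
antipode-injective (a ∷ xs) (b ∷ ys) e with ∷-injective e
... | na≡nb , e' = cong₂ _∷_ (not-injective na≡nb) (antipode-injective xs ys e')

-- A robber crossing an edge without landing next to the square cop lands on its antipode,
-- using up his spare move.
squareProgress : ∀ s r r' → Flip r r' → Progress square s r r'
squareProgress s r r' r↔r' with square-adjacent-or-antipodal s r'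
... | inj₁ adjacent = inj₂ (here adjacent)
... | inj₂ s≡ar' with s ≟ᶜ antipode r | s ≟ᶜ antipode r'
...   | yes s≡ar | _          = ⊥-elim (Flip-irreflexive (subst (Flip r) (sym r≡r') r↔r'))
  where
  r≡r' : r ≡ r'
  r≡r' = antipode-injective r r' (trans (sym s≡ar) s≡ar')
...   | no  _    | yes _      = inj₁ (s≤s z≤n)
...   | no  _    | no s≢ar'   = ⊥-elim (s≢ar' s≡ar')

joinProgressˡ : ∀ a b (A : Team a (dim b)) (B : Team b (dim a)) ra ra' rb →
  TeamProgress a A ra ra' (flatten b rb) →
  teamPotential b (advance b B rb (flatten a ra')) rb (flatten a ra') ≤ teamPotential b B rb (flatten a ra) →
  Progress (join a b) (A , B) (ra , rb) (ra' , rb)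
joinProgressˡ a b A B ra ra' rb (inj₁ lower)            steady = inj₁ (+-mono-≤ lower steady)
joinProgressˡ a b (sa , ._) B ra ra' rb (inj₂ (refl , threat)) _ =
  inj₂ (Any.++⁺ˡ (teamThreat a leftBlock sa (flatten b rb) ra' threat))

joinProgressʳ : ∀ a b (A : Team a (dim b)) (B : Team b (dim a)) ra rb rb' →
  teamPotential a (advance a A ra (flatten b rb')) ra (flatten b rb') ≤ teamPotential a A ra (flatten b rb) →
  TeamProgress b B rb rb' (flatten a ra) →
  Progress (join a b) (A , B) (ra , rb) (ra , rb')
joinProgressʳ a b A B ra rb rb' steady (inj₁ lower) =
  inj₁ (≤-trans (≤-reflexive (sym (+-suc _ _))) (+-mono-≤ steady lower))
joinProgressʳ a b A (sb , ._) ra rb rb' _ (inj₂ (refl , threat)) =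
  inj₂ (Any.++⁺ʳ (teamPositions a leftBlock A) (teamThreat b rightBlock sb (flatten a ra) rb' threat))

flipProgress : ∀ t s r r' → Flip (flatten t r) (flatten t r') → Progress t s r r'
flipProgress edge       s r r' _     = inj₂ (here (edge-adjacent s r'))
flipProgress square     s r r' r↔r'  = squareProgress s r r' r↔r'
flipProgress (join a b) (A , B) (ra , rb) (ra' , rb') f with Flip-++⁻ (flatten a ra) (flatten a ra') f
... | inj₁ (fa , eb) with flatten-injective b eb
...   | refl = joinProgressˡ a b A B ra ra' rb
                 (liftProgress a A ra ra' (flatten b rb) (flipProgress a (proj₁ A) ra ra' fa))
                 (advance-steady b B rb (inj₂ fa))
flipProgress (join a b) (A , B) (ra , rb) (ra' , rb') f | inj₂ (ea , fb) with flatten-injective a ea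
...   | refl = joinProgressʳ a b A B ra rb rb'
                 (advance-steady a A ra (inj₂ fb))
                 (liftProgress b B rb rb' (flatten a ra) (flipProgress b (proj₁ B) rb rb' fb))

stayProgress : ∀ t → EdgeFirst t → ∀ s r → Progress t s r r
stayProgress edge       _  s       r         = inj₂ (here (edge-adjacent s r))
stayProgress (join a b) ef (A , B) (ra , rb) =
  joinProgressˡ a b A B ra ra rb
    (liftProgress a A ra ra (flatten b rb) (stayProgress a ef (proj₁ A) ra))
    (advance-steady b B rb (inj₁ refl))

progress : ∀ t → EdgeFirst t → ∀ s r r' → Adjacent (flatten t r) (flatten t r') → Progress t s r r'
progress t ef s r r' (inj₁ e) with flatten-injective t e
... | refl = stayProgress t ef s r
progress t ef s r r' (inj₂ f) = flipProgress t s r r' f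

someState : ∀ t → State t
someState edge       = replicate 1 false
someState square     = replicate 2 false
someState (join a b) = (someState a , replicate (dim b) false) , (someState b , replicate (dim a) false)

module _ (T : Tree) (ef : EdgeFirst T) where
  open GameFacts (Cube (dim T)) AdjQ (inj₁ refl)
  open Game (Cube (dim T)) AdjQ using (CaptureWithin)

  teamStrategy : PotentialStrategy (copCount T)
  teamStrategy = record
    { Config   = State T
    ; cops     = positions T
    ; respond  = λ s x → respond T s (split T x)
    ; Φ        = λ s x → potential T s (split T x)
    ; legal    = λ s x → Pointwise.map Adjacent⇒AdjQ (respond-legal T s (split T x))
    ; progress = progressQ
    }
    where
    progressQ : ∀ s x x' → AdjQ x x' →
                suc (potential T (respond T s (split T x')) (split T x')) ≤ potential T s (split T x)
                ⊎ Any (λ c → AdjQ c x') (positions T s)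
    progressQ s x x' x~x'
      with progress T ef s (split T x) (split T x')
             (subst₂ Adjacent (sym (flatten-split T x)) (sym (flatten-split T x')) (AdjQ⇒Adjacent x~x'))
    ... | inj₁ lower  = inj₁ lower
    ... | inj₂ threat = inj₂ (Any.map (λ c~r' → Adjacent⇒AdjQ (subst (Adjacent _) (flatten-split T x') c~r')) threat)

  -- Any initial configuration will do, since the potential never exceeds the bound.
  teamCapture : CaptureWithin (copCount T) (suc (bound T))
  teamCapture = potentialCapture teamStrategy s₀ (bound T) (λ x → potential≤bound T s₀ (split T x))
    where
    s₀ : State T
    s₀ = someState T

attach : ℕ → Tree → ℕ → Tree
attach zero    f m       = f
attach (suc h) f zero    = f
attach (suc h) f (suc m) = join (attach h f ⌈ m /2⌉) (attach h square ⌊ m /2⌋)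

attach-edgeFirst : ∀ h f m → EdgeFirst f → EdgeFirst (attach h f m)
attach-edgeFirst zero    f m       ef = ef
attach-edgeFirst (suc h) f zero    ef = ef
attach-edgeFirst (suc h) f (suc m) ef = attach-edgeFirst h f ⌈ m /2⌉ ef

halfRoomˡ : ∀ h m → suc (suc m) ≤ 2 ^ suc h → suc ⌈ m /2⌉ ≤ 2 ^ h
halfRoomˡ h m room = begin
  ⌈ suc (suc m) /2⌉         ≤⟨ ⌈n/2⌉-mono room ⟩
  ⌈ 2 ^ h + (2 ^ h + 0) /2⌉ ≡⟨ cong (λ q → ⌈ 2 ^ h + q /2⌉) (+-identityʳ (2 ^ h)) ⟩
  ⌈ 2 ^ h + 2 ^ h /2⌉       ≡⟨ sym (n≡⌈n+n/2⌉ (2 ^ h)) ⟩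
  2 ^ h                     ∎
  where open ≤-Reasoning

halfRoomʳ : ∀ h m → suc (suc m) ≤ 2 ^ suc h → suc ⌊ m /2⌋ ≤ 2 ^ h
halfRoomʳ h m room = ≤-trans (s≤s (⌊n/2⌋≤⌈n/2⌉ m)) (halfRoomˡ h m room)

attach-dim : ∀ h f m → suc m ≤ 2 ^ h → dim (attach h f m) ≡ dim f + 2 * m
attach-dim zero    f zero    _         = sym (+-identityʳ (dim f))
attach-dim zero    f (suc m) (s≤s ())
attach-dim (suc h) f zero    _         = sym (+-identityʳ (dim f))
attach-dim (suc h) f (suc m) room      = begin
  dim (attach h f ⌈ m /2⌉) + dim (attach h square ⌊ m /2⌋)
    ≡⟨ cong₂ _+_ (attach-dim h f ⌈ m /2⌉ roomˡ) (attach-dim h square ⌊ m /2⌋ roomʳ) ⟩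
  (dim f + 2 * ⌈ m /2⌉) + (2 + 2 * ⌊ m /2⌋)
    ≡⟨ regroup (dim f) ⌈ m /2⌉ ⌊ m /2⌋ ⟩
  dim f + 2 * suc (⌊ m /2⌋ + ⌈ m /2⌉)
    ≡⟨ cong (λ q → dim f + 2 * suc q) (⌊n/2⌋+⌈n/2⌉≡n m) ⟩
  dim f + 2 * suc m ∎
  where
  open ≡-Reasoning
  roomˡ : suc ⌈ m /2⌉ ≤ 2 ^ h
  roomˡ = halfRoomˡ h m room
  roomʳ : suc ⌊ m /2⌋ ≤ 2 ^ h
  roomʳ = halfRoomʳ h m room
  regroup : ∀ d p q → (d + 2 * p) + (2 + 2 * q) ≡ d + 2 * suc (q + p)
  regroup = solve-∀

attach-copCount : ∀ h f m → suc m ≤ 2 ^ h → copCount (attach h f m) ≡ copCount f + m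
attach-copCount zero    f zero    _    = sym (+-identityʳ (copCount f))
attach-copCount zero    f (suc m) (s≤s ())
attach-copCount (suc h) f zero    _    = sym (+-identityʳ (copCount f))
attach-copCount (suc h) f (suc m) room = begin
  copCount (attach h f ⌈ m /2⌉) + copCount (attach h square ⌊ m /2⌋)
    ≡⟨ cong₂ _+_ (attach-copCount h f ⌈ m /2⌉ roomˡ) (attach-copCount h square ⌊ m /2⌋ roomʳ) ⟩
  (copCount f + ⌈ m /2⌉) + (1 + ⌊ m /2⌋)
    ≡⟨ regroup (copCount f) ⌈ m /2⌉ ⌊ m /2⌋ ⟩
  copCount f + suc (⌊ m /2⌋ + ⌈ m /2⌉)
    ≡⟨ cong (λ q → copCount f + suc q) (⌊n/2⌋+⌈n/2⌉≡n m) ⟩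
  copCount f + suc m ∎
  where
  open ≡-Reasoning
  roomˡ : suc ⌈ m /2⌉ ≤ 2 ^ h
  roomˡ = halfRoomˡ h m room
  roomʳ : suc ⌊ m /2⌋ ≤ 2 ^ h
  roomʳ = halfRoomʳ h m room
  regroup : ∀ c p q → (c + p) + (1 + q) ≡ c + suc (q + p)
  regroup = solve-∀

-- Every coordinate is crossed by at most h joins, each contributing the other side's dimension.
attach-bound : ∀ h f m → suc m ≤ 2 ^ h → bound (attach h f m) ≤ (dim f + 2 * m) * h + bound f + m
attach-bound zero    f zero    _    = ≤-reflexive (sym (trans (+-identityʳ _) (cong (_+ bound f) (*-zeroʳ (dim f + 0)))))
attach-bound zero    f (suc m) (s≤s ())
attach-bound (suc h) f zero    _    = ≤-trans (m≤n+m (bound f) _) (m≤m+n _ 0)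
attach-bound (suc h) f (suc m) room = begin
  (dim R + bound L) + (dim L + bound R)
    ≡⟨ cong₂ (λ dR dL → (dR + bound L) + (dL + bound R))
             (attach-dim h square ⌊ m /2⌋ roomʳ) (attach-dim h f ⌈ m /2⌉ roomˡ) ⟩
  (2 + 2 * q + bound L) + (dim f + 2 * p + bound R)
    ≤⟨ +-mono-≤ (+-monoʳ-≤ (2 + 2 * q) (attach-bound h f p roomˡ))
                (+-monoʳ-≤ (dim f + 2 * p) (attach-bound h square q roomʳ)) ⟩
  (2 + 2 * q + ((dim f + 2 * p) * h + bound f + p)) + (dim f + 2 * p + ((2 + 2 * q) * h + 1 + q))
    ≡⟨ regroup (dim f) (bound f) h p q ⟩
  (dim f + 2 * suc (q + p)) * suc h + bound f + suc (q + p)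
    ≡⟨ cong (λ k → (dim f + 2 * suc k) * suc h + bound f + suc k) (⌊n/2⌋+⌈n/2⌉≡n m) ⟩
  (dim f + 2 * suc m) * suc h + bound f + suc m ∎
  where
  open ≤-Reasoning
  p q : ℕ
  p = ⌈ m /2⌉
  q = ⌊ m /2⌋
  L R : Tree
  L = attach h f p
  R = attach h square q
  roomˡ : suc ⌈ m /2⌉ ≤ 2 ^ h
  roomˡ = halfRoomˡ h m room
  roomʳ : suc ⌊ m /2⌋ ≤ 2 ^ h
  roomʳ = halfRoomʳ h m room
  regroup : ∀ d c h p q →
    (2 + 2 * q + ((d + 2 * p) * h + c + p)) + (d + 2 * p + ((2 + 2 * q) * h + 1 + q))
    ≡ (d + 2 * suc (q + p)) * suc h + c + suc (q + p)
  regroup = solve-∀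

attach-time : ∀ h f m → suc m ≤ 2 ^ h → bound f ≤ dim f →
              bound (attach h f m) + m ≤ (dim f + 2 * m) * suc h
attach-time h f m room bf≤df = begin
  bound (attach h f m) + m                ≤⟨ +-monoˡ-≤ m (attach-bound h f m room) ⟩
  (dim f + 2 * m) * h + bound f + m + m   ≤⟨ +-monoˡ-≤ m (+-monoˡ-≤ m (+-monoʳ-≤ ((dim f + 2 * m) * h) bf≤df)) ⟩
  (dim f + 2 * m) * h + dim f + m + m     ≡⟨ regroup (dim f) m h ⟩
  (dim f + 2 * m) * suc h                 ∎
  where
  open ≤-Reasoning
  regroup : ∀ d m h → (d + 2 * m) * h + d + m + m ≡ (d + 2 * m) * suc h
  regroup = solve-∀

≤2^⌈log2⌉ : ∀ n (rec : Acc _<_ n) → n ≤ 2 ^ ⌈log2⌉ n rec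
≤2^⌈log2⌉ zero          _        = z≤n
≤2^⌈log2⌉ (suc zero)    _        = s≤s z≤n
≤2^⌈log2⌉ (suc (suc n)) (acc rs) = begin
  2 + n                           ≤⟨ +-monoʳ-≤ 2 n≤⌈n/2⌉+⌈n/2⌉ ⟩
  2 + (⌈ n /2⌉ + ⌈ n /2⌉)         ≡⟨ double ⌈ n /2⌉ ⟩
  2 * suc ⌈ n /2⌉                 ≤⟨ *-monoʳ-≤ 2 (≤2^⌈log2⌉ (suc ⌈ n /2⌉) (rs (⌈n/2⌉<n n))) ⟩
  2 * 2 ^ ⌈log2⌉ (suc ⌈ n /2⌉) _  ∎
  where
  open ≤-Reasoning
  n≤⌈n/2⌉+⌈n/2⌉ : n ≤ ⌈ n /2⌉ + ⌈ n /2⌉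
  n≤⌈n/2⌉+⌈n/2⌉ = subst (_≤ ⌈ n /2⌉ + ⌈ n /2⌉) (⌊n/2⌋+⌈n/2⌉≡n n) (+-monoˡ-≤ ⌈ n /2⌉ (⌊n/2⌋≤⌈n/2⌉ n))
  double : ∀ x → 2 + (x + x) ≡ 2 * suc x
  double = solve-∀

⌈log₂⌉-halve : ∀ n → 2 ≤ n → ⌈log₂ n ⌉ ≡ suc ⌈log₂ ⌈ n /2⌉ ⌉
⌈log₂⌉-halve n 2≤n = begin
  ⌈log₂ n ⌉             ≡⟨ sym (m∸n+n≡m (⌈log₂⌉-mono-≤ 2≤n)) ⟩
  ⌈log₂ n ⌉ ∸ 1 + 1     ≡⟨ +-comm (⌈log₂ n ⌉ ∸ 1) 1 ⟩
  suc (⌈log₂ n ⌉ ∸ 1)   ≡⟨ cong suc (sym (⌈log₂⌈n/2⌉⌉≡⌈log₂n⌉∸1 n)) ⟩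
  suc ⌈log₂ ⌈ n /2⌉ ⌉   ∎
  where open ≡-Reasoning

-- The seed for Q_{k+1}: one edge cop if k is even, two edge cops if k is odd; together
-- with ⌊k/2⌋ square cops it fills k + 1 coordinates with ⌈(k+2)/2⌉ cops.
seed : ℕ → Tree
seed zero          = edge
seed (suc zero)    = join edge edge
seed (suc (suc k)) = seed k

seed-edgeFirst : ∀ k → EdgeFirst (seed k)
seed-edgeFirst zero          = tt
seed-edgeFirst (suc zero)    = tt
seed-edgeFirst (suc (suc k)) = seed-edgeFirst k

seed-bound : ∀ k → bound (seed k) ≤ dim (seed k)
seed-bound zero          = z≤n
seed-bound (suc zero)    = ≤-refl
seed-bound (suc (suc k)) = seed-bound k

seed-dim : ∀ k → dim (seed k) + 2 * ⌊ k /2⌋ ≡ suc k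
seed-dim zero          = refl
seed-dim (suc zero)    = refl
seed-dim (suc (suc k)) = begin
  dim (seed k) + 2 * suc ⌊ k /2⌋    ≡⟨ cong (dim (seed k) +_) (*-suc 2 ⌊ k /2⌋) ⟩
  dim (seed k) + (2 + 2 * ⌊ k /2⌋)  ≡⟨ trans (+-suc _ _) (cong suc (+-suc _ _)) ⟩
  2 + (dim (seed k) + 2 * ⌊ k /2⌋)  ≡⟨ cong (2 +_) (seed-dim k) ⟩
  suc (suc (suc k))                 ∎
  where open ≡-Reasoning

seed-copCount : ∀ k → copCount (seed k) + ⌊ k /2⌋ ≡ ⌈ suc k + 1 /2⌉
seed-copCount zero          = refl
seed-copCount (suc zero)    = refl
seed-copCount (suc (suc k)) = trans (+-suc (copCount (seed k)) ⌊ k /2⌋) (cong suc (seed-copCount k))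

treeCapture : ∀ {n k t} T → EdgeFirst T → dim T ≡ n → copCount T ≡ k → suc (bound T) ≤ t →
              Game.CaptureWithin (Cube n) (AdjQ {n}) k t
treeCapture T ef refl refl bound<t = CaptureWithin-mono bound<t (teamCapture T ef)
  where open GameFacts (Cube (dim T)) AdjQ (inj₁ refl)

-- Rewriting c + m ≤ N into the shape of the stated capture time (truncated subtraction).
shift-bound : ∀ {c m N} → c + m ≤ N → suc c ≤ (N ∸ m) + 1
shift-bound {c} {m} {N} c+m≤N = subst (_≤ (N ∸ m) + 1) (+-comm c 1) (+-monoˡ-≤ 1 (m+n≤o⇒m≤o∸n c c+m≤N))

corollary2p3 : (n : ℕ) → .{{_ : NonZero n}} →
    Game.CaptureWithin (Cube n) (AdjQ {n}) ⌈ n + 1 /2⌉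
      ((n * ⌈log₂ n ⌉ ∸ ⌊ n ∸ 1 /2⌋) + 1)
-- Q_1: one edge cop catches in one round.  n ≥ 2: the seed for n plus ⌊(n−1)/2⌋ square
-- cops at depth h = ⌈log₂ n⌉ − 1, which fits since ⌈n/2⌉ ≤ 2^h.
corollary2p3 (suc zero)      = teamCapture edge tt
corollary2p3 n@(suc (suc k)) =
  treeCapture T (attach-edgeFirst h f m (seed-edgeFirst (suc k))) dim≡n
    (trans (attach-copCount h f m room) (seed-copCount (suc k))) time
  where
  m h : ℕ
  m = ⌊ suc k /2⌋
  h = ⌈log₂ ⌈ n /2⌉ ⌉
  f T : Tree
  f = seed (suc k)
  T = attach h f m
  room : suc m ≤ 2 ^ h
  room = ≤2^⌈log2⌉ ⌈ n /2⌉ _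
  dim≡n : dim T ≡ n
  dim≡n = trans (attach-dim h f m room) (seed-dim (suc k))
  time : suc (bound T) ≤ (n * ⌈log₂ n ⌉ ∸ m) + 1
  time = shift-bound (subst₂ (λ N L → bound T + m ≤ N * L) (seed-dim (suc k)) (sym (⌈log₂⌉-halve n (s≤s (s≤s z≤n))))
                             (attach-time h f m room (seed-bound (suc k))))
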